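{- For all (well-formed) CPC patterns $p$ and $q$, if the unification $\{p\|q\}$ is defined, then every protected name of $p$ is a free name of $q$, i.e. ${\sf pn}(p)\subseteq{\sf fn}(q)$.
   Context: Names: a countably infinite set. Patterns: $p ::= \lambda x \mid x \mid \ulcorner x\urcorner \mid p\bullet p$ (binding name, variable name, protected name, compound). ${\sf vn}(p),{\sf pn}(p),{\sf bn}(p)$ are the variable, protected and binding names of $p$; ${\sf fn}(p)={\sf vn}(p)\cup{\sf pn}(p)$. Well formed: binding names pairwise distinct and disjoint from free names. A pattern is communicable if it has no protected and no binding names. Unification $\{p\|q\}$ (a partial pair of substitutions): $\{x\|x\}=\{x\|\ulcorner x\urcorner\}=\{\ulcorner x\urcorner\|x\}=\{\ulcorner x\urcorner\|\ulcorner x\urcorner\}=(\{\},\{\})$; $\{\lambda x\|q\}=(\{q/x\},\{\})$ if $q$ communicable; $\{p\|\lambda x\}=(\{\},\{p/x\})$ if $p$ communicable; $\{p_1\bullet p_2\|q_1\bullet q_2\}=(\sigma_1\cup\sigma_2,\rho_1\cup\rho_2)$ if $\{p_i\|q_i\}=(\sigma_i,\rho_i)$ for $i=1,2$; undefined otherwise. -}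

module Defs where

open import Data.Nat using (ℕ)
open import Data.List using (List; []; _∷_; _++_)
open import Data.List.Membership.Propositional using (_∈_)
open import Data.List.Relation.Unary.Unique.Propositional using (Unique)
open import Data.List.Relation.Unary.All using (All)
open import Data.Maybe using (Maybe; just; nothing)
open import Data.Product using (_×_; _,_)
open import Relation.Nullary using (¬_)
open import Relation.Nullary.Decidable using (⌊_⌋)
open import Data.Nat using (_≟_)
open import Data.Bool using (Bool; true; false; _∧_; if_then_else_)

Name : Set
Name = ℕ

-- Patterns  p ::= λx | x | ⌜x⌝ | p • p
data Pattern : Set where
  bind  : Name → Pattern
  var   : Name → Pattern
  prot  : Name → Pattern
  _•_   : Pattern → Pattern → Pattern

vn : Pattern → List Name
vn (bind x) = []
vn (var x)  = x ∷ []
vn (prot x) = []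
vn (p • q)  = vn p ++ vn q

pn : Pattern → List Name
pn (bind x) = []
pn (var x)  = []
pn (prot x) = x ∷ []
pn (p • q)  = pn p ++ pn q

-- binding names (list, so that repetitions are visible)
bn : Pattern → List Name
bn (bind x) = x ∷ []
bn (var x)  = []
bn (prot x) = []
bn (p • q)  = bn p ++ bn q

fn : Pattern → List Name
fn p = vn p ++ pn p

WellFormed : Pattern → Set
WellFormed p = Unique (bn p) × All (λ x → ¬ (x ∈ fn p)) (bn p)

isEmpty : List Name → Bool
isEmpty []      = true
isEmpty (_ ∷ _) = false

communicable : Pattern → Bool
communicable p = isEmpty (pn p) ∧ isEmpty (bn p)

Subst : Set
Subst = List (Name × Pattern)

-- Unification {p || q}: a partial pair of substitutions (nothing = undefined).
-- Union of substitutions is list concatenation (well-formedness makes the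
-- domains disjoint).
unify : Pattern → Pattern → Maybe (Subst × Subst)
unify (var x)  (var y)  = if ⌊ x ≟ y ⌋ then just ([] , []) else nothing
unify (var x)  (prot y) = if ⌊ x ≟ y ⌋ then just ([] , []) else nothing
unify (prot x) (var y)  = if ⌊ x ≟ y ⌋ then just ([] , []) else nothing
unify (prot x) (prot y) = if ⌊ x ≟ y ⌋ then just ([] , []) else nothing
unify (bind x) q = if communicable q then just ((x , q) ∷ [] , []) else nothing
unify p (bind x) = if communicable p then just ([] , (x , p) ∷ []) else nothing
unify (p₁ • p₂) (q₁ • q₂) with unify p₁ q₁ | unify p₂ q₂
... | just (σ₁ , ρ₁) | just (σ₂ , ρ₂) = just (σ₁ ++ σ₂ , ρ₁ ++ ρ₂)
... | _ | _ = nothing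
unify _ _ = nothing

module Submission where

-- The proof is a structural induction on p and q that follows the clauses of
-- unification.

open import Defs
open import Data.Bool using (Bool; true; false; if_then_else_)
open import Data.List using (List; []; _∷_; _++_)
open import Data.List.Membership.Propositional using (_∈_)
open import Data.List.Membership.Propositional.Properties using (∈-++⁻)
open import Data.List.Relation.Binary.Subset.Propositional using (_⊆_)
open import Data.List.Relation.Binary.Subset.Propositional.Properties
  using (⊆-trans; xs⊆xs++ys; xs⊆ys++xs; ++⁺)
open import Data.List.Relation.Unary.Any using (here)
open import Data.Maybe using (Maybe; just; nothing)
open import Data.Nat using (_≟_)
open import Data.Product using (_×_; ∃; _,_)
open import Data.Sum using (inj₁; inj₂)
open import Relation.Binary.PropositionalEquality using (_≡_; refl; sym; trans)
open import Relation.Nullary using (yes; no)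
open import Relation.Nullary.Decidable using (⌊_⌋)

Unifiable : Pattern → Pattern → Set
Unifiable p q = ∃ λ σρ → unify p q ≡ just σρ

++-⊆ : {A : Set} {xs ys zs : List A} → xs ⊆ zs → ys ⊆ zs → xs ++ ys ⊆ zs
++-⊆ {xs = xs} xs⊆zs ys⊆zs m with ∈-++⁻ xs m
... | inj₁ m₁ = xs⊆zs m₁
... | inj₂ m₂ = ys⊆zs m₂

fn-•ˡ : (q₁ q₂ : Pattern) → fn q₁ ⊆ fn (q₁ • q₂)
fn-•ˡ q₁ q₂ = ++⁺ (xs⊆xs++ys (vn q₁) (vn q₂)) (xs⊆xs++ys (pn q₁) (pn q₂))

fn-•ʳ : (q₁ q₂ : Pattern) → fn q₂ ⊆ fn (q₁ • q₂)
fn-•ʳ q₁ q₂ = ++⁺ (xs⊆ys++xs (vn q₂) (vn q₁)) (xs⊆ys++xs (pn q₂) (pn q₁))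

protected⇒¬communicable : ∀ {x} (p : Pattern) → x ∈ pn p → communicable p ≡ false
protected⇒¬communicable p m with pn p | m
... | _ ∷ _ | _ = refl

name-test-succeeds : ∀ {A : Set} {x y} {a b : A} →
  (if ⌊ x ≟ y ⌋ then just a else nothing) ≡ just b → x ≡ y
name-test-succeeds {x = x} {y} e with x ≟ y
... | yes x≡y = x≡y
name-test-succeeds () | no _

guard-holds : ∀ {A : Set} {c : Bool} {a b : A} →
  (if c then just a else nothing) ≡ just b → c ≡ true
guard-holds {c = true} _ = refl

unifiable-• : (p₁ p₂ q₁ q₂ : Pattern) →
  Unifiable (p₁ • p₂) (q₁ • q₂) → Unifiable p₁ q₁ × Unifiable p₂ q₂
unifiable-• p₁ p₂ q₁ q₂ (_ , e) with unify p₁ q₁ | unify p₂ q₂ | e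
... | just σρ₁ | just σρ₂ | _ = (σρ₁ , refl) , (σρ₂ , refl)

-- Patterns λx and x have no protected names, so only ⌜x⌝ and compounds
-- need treatment; impossible unifications are refuted by computation.
unifiable⇒pn⊆fn : (p q : Pattern) → Unifiable p q → pn p ⊆ fn q
unifiable⇒pn⊆fn (prot x) (var y)  (_ , e) (here z≡x) = here (trans z≡x (name-test-succeeds e))
unifiable⇒pn⊆fn (prot x) (prot y) (_ , e) (here z≡x) = here (trans z≡x (name-test-succeeds e))
unifiable⇒pn⊆fn (prot x) (bind y) (_ , ()) _
unifiable⇒pn⊆fn (prot x) (_ • _)  (_ , ()) _
unifiable⇒pn⊆fn (p₁ • p₂) (bind y) (_ , e) m
  with () ← trans (sym (protected⇒¬communicable (p₁ • p₂) m))
                  (guard-holds {c = communicable (p₁ • p₂)} e)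
unifiable⇒pn⊆fn (p₁ • p₂) (var y)  (_ , ()) _
unifiable⇒pn⊆fn (p₁ • p₂) (prot y) (_ , ()) _
unifiable⇒pn⊆fn (p₁ • p₂) (q₁ • q₂) d
  with unifiable-• p₁ p₂ q₁ q₂ d
... | d₁ , d₂ = ++-⊆ (⊆-trans (unifiable⇒pn⊆fn p₁ q₁ d₁) (fn-•ˡ q₁ q₂))
                     (⊆-trans (unifiable⇒pn⊆fn p₂ q₂ d₂) (fn-•ʳ q₁ q₂))

proposition2p2 : (p q : Pattern) → WellFormed p → WellFormed q → (∃ λ σρ → unify p q ≡ just σρ) → ∀ {x} → x ∈ pn p → x ∈ fn q
proposition2p2 p q _ _ = unifiable⇒pn⊆fn p q
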